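{- The set of fundamental elements of the Gaussian partial field $\mathbb{H}_2$ is $\mathcal{F}(\mathbb{H}_2)=\left\{0,1,-1,2,\tfrac12,i,i+1,\tfrac{i+1}{2},1-i,\tfrac{1-i}{2},-i\right\}$.
   Context: $\mathbb{H}_2$ has underlying set $\{0\}\cup\{\pm i^a(1-i)^b:a,b\in\mathbb{Z}\}\subseteq\mathbb{C}$ where $i^2=-1$, multiplication as in $\mathbb{C}$, and $p+q$ defined exactly when the complex sum lies in this set. An element $p$ is fundamental if $1-p$ also lies in this set. -}

module Defs where

open import Data.Nat using (ℕ; zero; suc)
open import Data.Integer using (ℤ; +_; -[1+_])
open import Data.Rational using (ℚ; 0ℚ; 1ℚ; ½; -½)
  renaming (_+_ to _+ℚ_; _*_ to _*ℚ_; _-_ to _-ℚ_; -_ to -ℚ_)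
open import Data.Product using (Σ; _×_; ∃; _,_)
open import Data.Sum using (_⊎_)
open import Data.List using (List; []; _∷_)
open import Relation.Binary.PropositionalEquality using (_≡_)

-- Gaussian rationals ℚ(i) ⊆ ℂ, represented as pairs (re, im) of
-- (normalised) rationals, so that _≡_ is equality of complex numbers.
record ℚi : Set where
  constructor _+i_
  field
    re : ℚ
    im : ℚ
open ℚi public

infixl 6 _+G_ _-G_
infixl 7 _*G_

_+G_ : ℚi → ℚi → ℚi
(a +i b) +G (c +i d) = (a +ℚ c) +i (b +ℚ d)

-G_ : ℚi → ℚi
-G (a +i b) = (-ℚ a) +i (-ℚ b)

_-G_ : ℚi → ℚi → ℚi
z -G w = z +G (-G w)

_*G_ : ℚi → ℚi → ℚi
(a +i b) *G (c +i d) = ((a *ℚ c) -ℚ (b *ℚ d)) +i ((a *ℚ d) +ℚ (b *ℚ c))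

0G 1G iG : ℚi
0G = 0ℚ +i 0ℚ
1G = 1ℚ +i 0ℚ
iG = 0ℚ +i 1ℚ

_^G_ : ℚi → ℕ → ℚi
z ^G zero    = 1G
z ^G (suc n) = z *G (z ^G n)

powℤ : (u u⁻¹ : ℚi) → ℤ → ℚi
powℤ u u⁻¹ (+ n)      = u ^G n
powℤ u u⁻¹ -[1+ n ]   = u⁻¹ ^G (suc n)

1-iG : ℚi
1-iG = 1ℚ +i (-ℚ 1ℚ)

i⁻¹G : ℚi
i⁻¹G = 0ℚ +i (-ℚ 1ℚ)

[1-i]⁻¹G : ℚi
[1-i]⁻¹G = ½ +i ½

i^ : ℤ → ℚi
i^ = powℤ iG i⁻¹G

[1-i]^ : ℤ → ℚi
[1-i]^ = powℤ 1-iG [1-i]⁻¹G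

open import Relation.Binary.PropositionalEquality using (refl)

i-inv : iG *G i⁻¹G ≡ 1G
i-inv = refl

1-i-inv : 1-iG *G [1-i]⁻¹G ≡ 1G
1-i-inv = refl

InH₂ : ℚi → Set
InH₂ z = (z ≡ 0G)
       ⊎ (Σ ℤ λ a → Σ ℤ λ b →
            (z ≡ i^ a *G [1-i]^ b) ⊎ (z ≡ -G (i^ a *G [1-i]^ b)))

-- p is fundamental in ℍ₂: p ∈ ℍ₂ and 1 - p ∈ ℍ₂
-- (i.e. p + (1-p) = 1 is a defined sum in ℍ₂)
Fundamental : ℚi → Set
Fundamental p = InH₂ p × InH₂ (1G -G p)

claimedFundamentals : List ℚi
claimedFundamentals =
    (0ℚ +i 0ℚ)
  ∷ (1ℚ +i 0ℚ)
  ∷ ((-ℚ 1ℚ) +i 0ℚ)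
  ∷ ((1ℚ +ℚ 1ℚ) +i 0ℚ)
  ∷ (½ +i 0ℚ)
  ∷ (0ℚ +i 1ℚ)
  ∷ (1ℚ +i 1ℚ)
  ∷ (½ +i ½)
  ∷ (1ℚ +i (-ℚ 1ℚ))
  ∷ (½ +i -½)
  ∷ (0ℚ +i (-ℚ 1ℚ))
  ∷ []

-- Every nonzero element of ℍ₂ has the shape q (s + t i) with q a power of two and s, t ∈ {0, ±1}:
-- this shape is preserved by multiplication with i^{±1} and (1 - i)^{±1}, rescaling q by 1, 2 or ½.
-- If p and 1 - p both have this shape, the real and imaginary parts of p + (1 - p) = 1 give
-- s q + s′ q′ = 1 and t q + t′ q′ = 0. Since there is no power of two strictly between x and 2x,
-- two powers of two summing to 1 are both ½, and 1 + y = z forces y = 1; the remaining cases are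
-- settled by signs, leaving exactly the eleven listed elements.
module Submission where

open import Data.Empty using (⊥; ⊥-elim)
open import Data.Integer as ℤ using (ℤ; +_; -[1+_]; ∣_∣)
import Data.Integer.Properties as ℤP
import Data.Integer.Tactic.RingSolver as ℤ-Solver
open import Data.List.Relation.Unary.All as All using (All; []; _∷_)
open import Data.Nat using (ℕ; zero; suc)
open import Data.Product using (∃; _,_; _×_)
open import Data.Rational as ℚ using (ℚ; 0ℚ; 1ℚ; ½; _+_; _*_; -_; _<_; _≤_)
import Data.Rational.Properties as ℚP
open import Algebra.Properties.Group ℚP.+-0-group using (⁻¹-involutive; x∙y⁻¹≈ε⇒x≈y)
open import Data.Sum using (inj₁; inj₂)
open import Function using (_∘_)
open import Level using (0ℓ)
open import Relation.Binary.Definitions using (DecidableEquality; tri<; tri≈; tri>)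
open import Relation.Binary.PropositionalEquality
open import Relation.Nullary using (yes; no)
open import Relation.Nullary.Decidable using (True; toWitness; map′; _×-dec_; dec⇒maybe)
open import Tactic.RingSolver using (solve-∀)
open import Tactic.RingSolver.Core.AlmostCommutativeRing using (AlmostCommutativeRing; fromCommutativeRing)

open import Defs

ℚ-ring : AlmostCommutativeRing 0ℓ 0ℓ
ℚ-ring = fromCommutativeRing ℚP.+-*-commutativeRing (λ x → dec⇒maybe (0ℚ ℚP.≟ x))

0<1 : 0ℚ < 1ℚ
0<1 = ℚP.positive⁻¹ 1ℚ

x<x+y : ∀ x {y} → 0ℚ < y → x < x + y
x<x+y x 0<y = subst (_< x + _) (ℚP.+-identityʳ x) (ℚP.+-monoʳ-< x 0<y)

≤⇒≯ : ∀ {x y} → x ≤ y → y < x → ⊥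
≤⇒≯ x≤y y<x = ℚP.<-irrefl refl (ℚP.≤-<-trans x≤y y<x)

-pos<0 : ∀ {x} → 0ℚ < x → - x < 0ℚ
-pos<0 = ℚP.neg-antimono-<

>0⇒≢0 : ∀ {x} → 0ℚ < x → x ≢ 0ℚ
>0⇒≢0 0<x = ℚP.<⇒≢ 0<x ∘ sym

[x+x]*½≡x : ∀ x → (x + x) * ½ ≡ x
[x+x]*½≡x = solve-∀ ℚ-ring

step-mono⇒mono : (f : ℤ → ℚ) → (∀ m → f m ≤ f (ℤ.suc m)) → ∀ {m n} → m ℤ.≤ n → f m ≤ f n
step-mono⇒mono f f-step {m} {n} m≤n = subst (λ k → f m ≤ f k) m+∣n-m∣≡n (steps ∣ n ℤ.- m ∣)
  where
  i+[j-i]≡j : ∀ i j → i ℤ.+ (j ℤ.- i) ≡ j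
  i+[j-i]≡j = ℤ-Solver.solve-∀
  1+[i+j]≡i+[1+j] : ∀ i j → ℤ.1ℤ ℤ.+ (i ℤ.+ j) ≡ i ℤ.+ (ℤ.1ℤ ℤ.+ j)
  1+[i+j]≡i+[1+j] = ℤ-Solver.solve-∀
  m+∣n-m∣≡n : m ℤ.+ + ∣ n ℤ.- m ∣ ≡ n
  m+∣n-m∣≡n = trans (cong (λ j → m ℤ.+ j) (ℤP.0≤i⇒+∣i∣≡i (ℤP.i≤j⇒0≤j-i m≤n))) (i+[j-i]≡j m n)
  steps : ∀ k → f m ≤ f (m ℤ.+ + k)
  steps zero    = subst (λ j → f m ≤ f j) (sym (ℤP.+-identityʳ m)) ℚP.≤-refl
  steps (suc k) = ℚP.≤-trans (steps k)
    (subst (λ j → f (m ℤ.+ + k) ≤ f j) (1+[i+j]≡i+[1+j] m (+ k)) (f-step (m ℤ.+ + k)))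

2^ℕ : ℕ → ℚ
2^ℕ zero    = 1ℚ
2^ℕ (suc n) = 2^ℕ n + 2^ℕ n

½^ℕ : ℕ → ℚ
½^ℕ zero    = 1ℚ
½^ℕ (suc n) = ½ * ½^ℕ n

2^_ : ℤ → ℚ
2^ (+ n)    = 2^ℕ n
2^ -[1+ n ] = ½^ℕ (suc n)

2^-suc : ∀ m → 2^ ℤ.suc m ≡ 2^ m + 2^ m
2^-suc (+ n)         = refl
2^-suc -[1+ zero ]   = refl
2^-suc -[1+ suc n ]  = x≡½x+½x (½^ℕ (suc n))
  where
  x≡½x+½x : ∀ x → x ≡ ½ * x + ½ * x
  x≡½x+½x = solve-∀ ℚ-ring

2^-pos : ∀ m → 0ℚ < 2^ m
2^-pos (+ zero)     = 0<1
2^-pos (+ suc n)    = ℚP.+-mono-< (2^-pos (+ n)) (2^-pos (+ n))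
2^-pos -[1+ zero ]  = ℚP.positive⁻¹ ½
2^-pos -[1+ suc n ] = ℚP.*-monoʳ-<-pos ½ (2^-pos -[1+ n ])

2^-mono-≤ : ∀ {m n} → m ℤ.≤ n → 2^ m ≤ 2^ n
2^-mono-≤ = step-mono⇒mono 2^_ 2^m≤2^[1+m]
  where
  2^m≤2^[1+m] : ∀ m → 2^ m ≤ 2^ ℤ.suc m
  2^m≤2^[1+m] m = subst (2^ m ≤_) (sym (2^-suc m)) (ℚP.<⇒≤ (x<x+y (2^ m) (2^-pos m)))

IsPowerOfTwo : ℚ → Set
IsPowerOfTwo q = ∃ λ m → 2^ m ≡ q

1-isPowerOfTwo : IsPowerOfTwo 1ℚ
1-isPowerOfTwo = + 0 , refl

powerOfTwo-pos : ∀ {q} → IsPowerOfTwo q → 0ℚ < q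
powerOfTwo-pos (m , refl) = 2^-pos m

powerOfTwo-<⇒double≤ : ∀ {x z} → IsPowerOfTwo x → IsPowerOfTwo z → x < z → x + x ≤ z
powerOfTwo-<⇒double≤ (m , refl) (n , refl) 2^m<2^n with n ℤP.≤? m
... | yes n≤m = ⊥-elim (≤⇒≯ (2^-mono-≤ n≤m) 2^m<2^n)
... | no  n≰m = subst (_≤ 2^ n) (2^-suc m) (2^-mono-≤ (ℤP.i<j⇒suc[i]≤j (ℤP.≰⇒> n≰m)))

x+y≡1⇒x≡½ : ∀ {x y} → IsPowerOfTwo x → IsPowerOfTwo y → x + y ≡ 1ℚ → x ≡ ½
x+y≡1⇒x≡½ {x} {y} x-pow y-pow x+y≡1 with ℚP.<-cmp x y
... | tri< x<y _ _ =
  ⊥-elim (≤⇒≯ (powerOfTwo-<⇒double≤ y-pow 1-isPowerOfTwo y<1) (subst (_< y + y) x+y≡1 (ℚP.+-monoˡ-< y x<y)))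
  where
  y<1 : y < 1ℚ
  y<1 = subst (y <_) (trans (ℚP.+-comm y x) x+y≡1) (x<x+y y (powerOfTwo-pos x-pow))
... | tri≈ _ refl _ = trans (sym ([x+x]*½≡x x)) (cong (_* ½) x+y≡1)
... | tri> _ _ y<x =
  ⊥-elim (≤⇒≯ (powerOfTwo-<⇒double≤ x-pow 1-isPowerOfTwo x<1) (subst (_< x + x) x+y≡1 (ℚP.+-monoʳ-< x y<x)))
  where
  x<1 : x < 1ℚ
  x<1 = subst (x <_) x+y≡1 (x<x+y x (powerOfTwo-pos y-pow))

1+y≡z⇒y≡1 : ∀ {y z} → IsPowerOfTwo y → IsPowerOfTwo z → 1ℚ + y ≡ z → y ≡ 1ℚ
1+y≡z⇒y≡1 {y} {z} y-pow z-pow 1+y≡z with ℚP.<-cmp y 1ℚ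
... | tri< y<1 _ _ =
  ⊥-elim (≤⇒≯ (powerOfTwo-<⇒double≤ 1-isPowerOfTwo z-pow 1<z) (subst (_< 1ℚ + 1ℚ) 1+y≡z (ℚP.+-monoʳ-< 1ℚ y<1)))
  where
  1<z : 1ℚ < z
  1<z = subst (1ℚ <_) 1+y≡z (x<x+y 1ℚ (powerOfTwo-pos y-pow))
... | tri≈ _ y≡1 _ = y≡1
... | tri> _ _ 1<y =
  ⊥-elim (≤⇒≯ (powerOfTwo-<⇒double≤ y-pow z-pow y<z) (subst (_< y + y) 1+y≡z (ℚP.+-monoˡ-< y 1<y)))
  where
  y<z : y < z
  y<z = subst (y <_) (trans (ℚP.+-comm y 1ℚ) 1+y≡z) (x<x+y y 0<1)

ScalesPowersOfTwo : ℚ → Set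
ScalesPowersOfTwo k = ∀ {q} → IsPowerOfTwo q → IsPowerOfTwo (q * k)

scales-1 : ScalesPowersOfTwo 1ℚ
scales-1 (m , refl) = m , sym (ℚP.*-identityʳ (2^ m))

scales-2 : ScalesPowersOfTwo (1ℚ + 1ℚ)
scales-2 (m , refl) = ℤ.suc m , trans (2^-suc m) (x+x≡x*2 (2^ m))
  where
  x+x≡x*2 : ∀ x → x + x ≡ x * (1ℚ + 1ℚ)
  x+x≡x*2 = solve-∀ ℚ-ring

scales-½ : ScalesPowersOfTwo ½
scales-½ (m , refl) = ℤ.pred m , (begin
  2^ ℤ.pred m                       ≡⟨ [x+x]*½≡x (2^ ℤ.pred m) ⟨
  (2^ ℤ.pred m + 2^ ℤ.pred m) * ½   ≡⟨ cong (_* ½) (2^-suc (ℤ.pred m)) ⟨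
  2^ ℤ.suc (ℤ.pred m) * ½           ≡⟨ cong (λ j → 2^ j * ½) (ℤP.suc-pred m) ⟩
  2^ m * ½                          ∎)
  where open ≡-Reasoning

*G-identityˡ : ∀ z → 1G *G z ≡ z
*G-identityˡ (a +i b) = cong₂ _+i_ (re-lemma a b) (im-lemma a b)
  where
  re-lemma : ∀ a b → 1ℚ * a ℚ.- 0ℚ * b ≡ a
  re-lemma = solve-∀ ℚ-ring
  im-lemma : ∀ a b → 1ℚ * b + 0ℚ * a ≡ b
  im-lemma = solve-∀ ℚ-ring

*G-identityʳ : ∀ z → z *G 1G ≡ z
*G-identityʳ (a +i b) = cong₂ _+i_ (re-lemma a b) (im-lemma a b)
  where
  re-lemma : ∀ a b → a * 1ℚ ℚ.- b * 0ℚ ≡ a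
  re-lemma = solve-∀ ℚ-ring
  im-lemma : ∀ a b → a * 0ℚ + b * 1ℚ ≡ b
  im-lemma = solve-∀ ℚ-ring

*G-assoc : ∀ x y z → (x *G y) *G z ≡ x *G (y *G z)
*G-assoc (a +i b) (c +i d) (e +i f) = cong₂ _+i_ (re-lemma a b c d e f) (im-lemma a b c d e f)
  where
  re-lemma : ∀ a b c d e f →
             (a * c ℚ.- b * d) * e ℚ.- (a * d + b * c) * f ≡ a * (c * e ℚ.- d * f) ℚ.- b * (c * f + d * e)
  re-lemma = solve-∀ ℚ-ring
  im-lemma : ∀ a b c d e f →
             (a * c ℚ.- b * d) * f + (a * d + b * c) * e ≡ a * (c * f + d * e) + b * (c * e ℚ.- d * f)
  im-lemma = solve-∀ ℚ-ring

1-p≡p′⇒p+p′≡1 : ∀ {p p′} → 1G -G p ≡ p′ → p +G p′ ≡ 1G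
1-p≡p′⇒p+p′≡1 {a +i b} refl = cong₂ _+i_ (x+[y-x]≡y a 1ℚ) (x+[y-x]≡y b 0ℚ)
  where
  x+[y-x]≡y : ∀ x y → x + (y + - x) ≡ y
  x+[y-x]≡y = solve-∀ ℚ-ring

infixr 8 _⊙_

_⊙_ : ℚ → ℚi → ℚi
q ⊙ (a +i b) = (q * a) +i (q * b)

*G-⊙ : ∀ z q w → z *G q ⊙ w ≡ q ⊙ (z *G w)
*G-⊙ (a +i b) q (c +i d) = cong₂ _+i_ (re-lemma a b c d q) (im-lemma a b c d q)
  where
  re-lemma : ∀ a b c d q → a * (q * c) ℚ.- b * (q * d) ≡ q * (a * c ℚ.- b * d)
  re-lemma = solve-∀ ℚ-ring
  im-lemma : ∀ a b c d q → a * (q * d) + b * (q * c) ≡ q * (a * d + b * c)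
  im-lemma = solve-∀ ℚ-ring

⊙-⊙ : ∀ q k w → q ⊙ k ⊙ w ≡ (q * k) ⊙ w
⊙-⊙ q k (c +i d) = cong₂ _+i_ (sym (ℚP.*-assoc q k c)) (sym (ℚP.*-assoc q k d))

data Sign : Set where
  0ₛ +ₛ -ₛ : Sign

infixr 7 _·_

_·_ : Sign → ℚ → ℚ
0ₛ · q = 0ℚ
+ₛ · q = q
-ₛ · q = - q

opposite : Sign → Sign
opposite 0ₛ = 0ₛ
opposite +ₛ = -ₛ
opposite -ₛ = +ₛ

neg-· : ∀ s q → - (s · q) ≡ opposite s · q
neg-· 0ₛ q = refl
neg-· +ₛ q = refl
neg-· -ₛ q = ⁻¹-involutive q

·-scaled : ∀ s q → s · q ≡ q * (s · 1ℚ)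
·-scaled 0ₛ q = sym (ℚP.*-zeroʳ q)
·-scaled +ₛ q = sym (ℚP.*-identityʳ q)
·-scaled -ₛ q = -x≡x*-1 q
  where
  -x≡x*-1 : ∀ x → - x ≡ x * - 1ℚ
  -x≡x*-1 = solve-∀ ℚ-ring

[_,_]·_ : Sign → Sign → ℚ → ℚi
[ s , t ]· q = (s · q) +i (t · q)

[,]·-scaled : ∀ s t q → [ s , t ]· q ≡ q ⊙ [ s , t ]· 1ℚ
[,]·-scaled s t q = cong₂ _+i_ (·-scaled s q) (·-scaled t q)

record NormalForm (z : ℚi) : Set where
  constructor normalForm
  field
    s t          : Sign
    q            : ℚ
    q-powerOfTwo : IsPowerOfTwo q
    z≡[s,t]·q    : z ≡ [ s , t ]· q

MulClosed : ℚi → Set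
MulClosed g = ∀ {z} → NormalForm z → NormalForm (g *G z)

neg-normalForm : ∀ {z} → NormalForm z → NormalForm (-G z)
neg-normalForm (normalForm s t q q-pow refl) =
  normalForm (opposite s) (opposite t) q q-pow (cong₂ _+i_ (neg-· s q) (neg-· t q))

i-mulClosed : MulClosed iG
i-mulClosed (normalForm s t q q-pow refl) =
  normalForm (opposite t) s q q-pow
    (cong₂ _+i_ (trans (re-lemma (s · q) (t · q)) (neg-· t q)) (im-lemma (s · q) (t · q)))
  where
  re-lemma : ∀ x y → 0ℚ * x ℚ.- 1ℚ * y ≡ - y
  re-lemma = solve-∀ ℚ-ring
  im-lemma : ∀ x y → 0ℚ * y + 1ℚ * x ≡ x
  im-lemma = solve-∀ ℚ-ring

i⁻¹-mulClosed : MulClosed i⁻¹G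
i⁻¹-mulClosed (normalForm s t q q-pow refl) =
  normalForm t (opposite s) q q-pow
    (cong₂ _+i_ (re-lemma (s · q) (t · q)) (trans (im-lemma (s · q) (t · q)) (neg-· s q)))
  where
  re-lemma : ∀ x y → 0ℚ * x ℚ.- - 1ℚ * y ≡ y
  re-lemma = solve-∀ ℚ-ring
  im-lemma : ∀ x y → 0ℚ * y + - 1ℚ * x ≡ - x
  im-lemma = solve-∀ ℚ-ring

record Rescaling (g : ℚi) (s t : Sign) : Set where
  constructor rescaling
  field
    s′ t′             : Sign
    k                 : ℚ
    k-scales          : ScalesPowersOfTwo k
    g*[s,t]≡k⊙[s′,t′] : g *G [ s , t ]· 1ℚ ≡ k ⊙ [ s′ , t′ ]· 1ℚ

rescaling⇒mulClosed : ∀ {g} → (∀ s t → Rescaling g s t) → MulClosed g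
rescaling⇒mulClosed {g} table (normalForm s t q q-pow refl) with table s t
... | rescaling s′ t′ k k-scales eq = normalForm s′ t′ (q * k) (k-scales q-pow) (begin
  g *G [ s , t ]· q            ≡⟨ cong (g *G_) ([,]·-scaled s t q) ⟩
  g *G q ⊙ [ s , t ]· 1ℚ       ≡⟨ *G-⊙ g q _ ⟩
  q ⊙ (g *G [ s , t ]· 1ℚ)     ≡⟨ cong (q ⊙_) eq ⟩
  q ⊙ k ⊙ [ s′ , t′ ]· 1ℚ      ≡⟨ ⊙-⊙ q k _ ⟩
  (q * k) ⊙ [ s′ , t′ ]· 1ℚ    ≡⟨ [,]·-scaled s′ t′ (q * k) ⟨
  [ s′ , t′ ]· (q * k)         ∎)
  where open ≡-Reasoning

-- (1 - i)(s + t i) = (s + t) + (t - s) i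
1-i-mulClosed : MulClosed 1-iG
1-i-mulClosed = rescaling⇒mulClosed table
  where
  table : ∀ s t → Rescaling 1-iG s t
  table 0ₛ 0ₛ = rescaling 0ₛ 0ₛ 1ℚ scales-1 refl
  table 0ₛ +ₛ = rescaling +ₛ +ₛ 1ℚ scales-1 refl
  table 0ₛ -ₛ = rescaling -ₛ -ₛ 1ℚ scales-1 refl
  table +ₛ 0ₛ = rescaling +ₛ -ₛ 1ℚ scales-1 refl
  table +ₛ +ₛ = rescaling +ₛ 0ₛ (1ℚ + 1ℚ) scales-2 refl
  table +ₛ -ₛ = rescaling 0ₛ -ₛ (1ℚ + 1ℚ) scales-2 refl
  table -ₛ 0ₛ = rescaling -ₛ +ₛ 1ℚ scales-1 refl
  table -ₛ +ₛ = rescaling 0ₛ +ₛ (1ℚ + 1ℚ) scales-2 refl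
  table -ₛ -ₛ = rescaling -ₛ 0ₛ (1ℚ + 1ℚ) scales-2 refl

-- ½ (1 + i)(s + t i) = ½ ((s - t) + (s + t) i)
[1-i]⁻¹-mulClosed : MulClosed [1-i]⁻¹G
[1-i]⁻¹-mulClosed = rescaling⇒mulClosed table
  where
  table : ∀ s t → Rescaling [1-i]⁻¹G s t
  table 0ₛ 0ₛ = rescaling 0ₛ 0ₛ 1ℚ scales-1 refl
  table 0ₛ +ₛ = rescaling -ₛ +ₛ ½ scales-½ refl
  table 0ₛ -ₛ = rescaling +ₛ -ₛ ½ scales-½ refl
  table +ₛ 0ₛ = rescaling +ₛ +ₛ ½ scales-½ refl
  table +ₛ +ₛ = rescaling 0ₛ +ₛ 1ℚ scales-1 refl
  table +ₛ -ₛ = rescaling +ₛ 0ₛ 1ℚ scales-1 refl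
  table -ₛ 0ₛ = rescaling -ₛ -ₛ ½ scales-½ refl
  table -ₛ +ₛ = rescaling -ₛ 0ₛ 1ℚ scales-1 refl
  table -ₛ -ₛ = rescaling 0ₛ -ₛ 1ℚ scales-1 refl

^G-mulClosed : ∀ {g} → MulClosed g → ∀ n → MulClosed (g ^G n)
^G-mulClosed g-closed zero {z} z-nf = subst NormalForm (sym (*G-identityˡ z)) z-nf
^G-mulClosed {g} g-closed (suc n) {z} z-nf =
  subst NormalForm (sym (*G-assoc g (g ^G n) z)) (g-closed (^G-mulClosed g-closed n z-nf))

powℤ-mulClosed : ∀ {u u⁻¹} → MulClosed u → MulClosed u⁻¹ → ∀ a → MulClosed (powℤ u u⁻¹ a)
powℤ-mulClosed {u}         u-closed u⁻¹-closed (+ n)    = ^G-mulClosed {u} u-closed n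
powℤ-mulClosed {u⁻¹ = u⁻¹} u-closed u⁻¹-closed -[1+ n ] = ^G-mulClosed {u⁻¹} u⁻¹-closed (suc n)

[1-i]^-normalForm : ∀ b → NormalForm ([1-i]^ b)
[1-i]^-normalForm b = subst NormalForm (*G-identityʳ ([1-i]^ b))
  (powℤ-mulClosed 1-i-mulClosed [1-i]⁻¹-mulClosed b (normalForm +ₛ 0ₛ 1ℚ 1-isPowerOfTwo refl))

inH₂⇒normalForm : ∀ {z} → InH₂ z → NormalForm z
inH₂⇒normalForm (inj₁ refl)                = normalForm 0ₛ 0ₛ 1ℚ 1-isPowerOfTwo refl
inH₂⇒normalForm (inj₂ (a , b , inj₁ refl)) = powℤ-mulClosed i-mulClosed i⁻¹-mulClosed a ([1-i]^-normalForm b)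
inH₂⇒normalForm (inj₂ (a , b , inj₂ refl)) = neg-normalForm (inH₂⇒normalForm (inj₂ (a , b , inj₁ refl)))

data SumsToOne : Sign → Sign → ℚ → ℚ → Set where
  0+1  : ∀ {q}  → SumsToOne 0ₛ +ₛ q 1ℚ
  1+0  : ∀ {q′} → SumsToOne +ₛ 0ₛ 1ℚ q′
  ½+½  : SumsToOne +ₛ +ₛ ½ ½
  2-1  : SumsToOne +ₛ -ₛ (1ℚ + 1ℚ) 1ℚ
  -1+2 : SumsToOne -ₛ +ₛ 1ℚ (1ℚ + 1ℚ)

data SumsToZero : Sign → Sign → ℚ → ℚ → Set where
  0+0  : ∀ {q q′} → SumsToZero 0ₛ 0ₛ q q′
  q-q  : ∀ {q} → SumsToZero +ₛ -ₛ q q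
  -q+q : ∀ {q} → SumsToZero -ₛ +ₛ q q

x+-y≡z⇒z+y≡x : ∀ {x y z} → x + - y ≡ z → z + y ≡ x
x+-y≡z⇒z+y≡x {x} {y} refl = [x+-y]+y≡x x y
  where
  [x+-y]+y≡x : ∀ x y → (x + - y) + y ≡ x
  [x+-y]+y≡x = solve-∀ ℚ-ring

sumsToOne : ∀ {q q′} → IsPowerOfTwo q → IsPowerOfTwo q′ →
            ∀ s s′ → s · q + s′ · q′ ≡ 1ℚ → SumsToOne s s′ q q′
sumsToOne q-pow q′-pow 0ₛ 0ₛ ()
sumsToOne {q′ = q′} q-pow q′-pow 0ₛ +ₛ e with trans (sym (ℚP.+-identityˡ q′)) e
... | refl = 0+1
sumsToOne {q′ = q′} q-pow q′-pow 0ₛ -ₛ e =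
  ⊥-elim (ℚP.<⇒≢ (ℚP.<-trans (-pos<0 (powerOfTwo-pos q′-pow)) 0<1) (trans (sym (ℚP.+-identityˡ (- q′))) e))
sumsToOne {q} q-pow q′-pow +ₛ 0ₛ e with trans (sym (ℚP.+-identityʳ q)) e
... | refl = 1+0
sumsToOne {q} {q′} q-pow q′-pow +ₛ +ₛ e
  with x+y≡1⇒x≡½ q-pow q′-pow e | x+y≡1⇒x≡½ q′-pow q-pow (trans (ℚP.+-comm q′ q) e)
... | refl | refl = ½+½
sumsToOne {q} {q′} q-pow q′-pow +ₛ -ₛ e with x+-y≡z⇒z+y≡x {q} {q′} e
... | 1+q′≡q with 1+y≡z⇒y≡1 q′-pow q-pow 1+q′≡q
... | refl with 1+q′≡q
... | refl = 2-1
sumsToOne {q} q-pow q′-pow -ₛ 0ₛ e =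
  ⊥-elim (ℚP.<⇒≢ (ℚP.<-trans (-pos<0 (powerOfTwo-pos q-pow)) 0<1) (trans (sym (ℚP.+-identityʳ (- q))) e))
sumsToOne {q} {q′} q-pow q′-pow -ₛ +ₛ e with x+-y≡z⇒z+y≡x {q′} {q} (trans (ℚP.+-comm q′ (- q)) e)
... | 1+q≡q′ with 1+y≡z⇒y≡1 q-pow q′-pow 1+q≡q′
... | refl with 1+q≡q′
... | refl = -1+2
sumsToOne q-pow q′-pow -ₛ -ₛ e =
  ⊥-elim (ℚP.<⇒≢ (ℚP.<-trans (ℚP.+-mono-< (-pos<0 (powerOfTwo-pos q-pow)) (-pos<0 (powerOfTwo-pos q′-pow))) 0<1) e)

sumsToZero : ∀ {q q′} → 0ℚ < q → 0ℚ < q′ →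
             ∀ t t′ → t · q + t′ · q′ ≡ 0ℚ → SumsToZero t t′ q q′
sumsToZero           q>0 q′>0 0ₛ 0ₛ e = 0+0
sumsToZero {q′ = q′} q>0 q′>0 0ₛ +ₛ e = ⊥-elim (>0⇒≢0 q′>0 (trans (sym (ℚP.+-identityˡ q′)) e))
sumsToZero {q′ = q′} q>0 q′>0 0ₛ -ₛ e = ⊥-elim (ℚP.<⇒≢ (-pos<0 q′>0) (trans (sym (ℚP.+-identityˡ (- q′))) e))
sumsToZero {q}       q>0 q′>0 +ₛ 0ₛ e = ⊥-elim (>0⇒≢0 q>0 (trans (sym (ℚP.+-identityʳ q)) e))
sumsToZero           q>0 q′>0 +ₛ +ₛ e = ⊥-elim (>0⇒≢0 (ℚP.+-mono-< q>0 q′>0) e)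
sumsToZero {q} {q′}  q>0 q′>0 +ₛ -ₛ e with x∙y⁻¹≈ε⇒x≈y q q′ e
... | refl = q-q
sumsToZero {q}       q>0 q′>0 -ₛ 0ₛ e = ⊥-elim (ℚP.<⇒≢ (-pos<0 q>0) (trans (sym (ℚP.+-identityʳ (- q))) e))
sumsToZero {q} {q′}  q>0 q′>0 -ₛ +ₛ e with x∙y⁻¹≈ε⇒x≈y q′ q (trans (ℚP.+-comm q′ (- q)) e)
... | refl = -q+q
sumsToZero           q>0 q′>0 -ₛ -ₛ e = ⊥-elim (ℚP.<⇒≢ (ℚP.+-mono-< (-pos<0 q>0) (-pos<0 q′>0)) e)

_≟ᵢ_ : DecidableEquality ℚi
(a +i b) ≟ᵢ (c +i d) =
  map′ (λ (a≡c , b≡d) → cong₂ _+i_ a≡c b≡d) (λ eq → cong re eq , cong im eq) ((a ℚP.≟ c) ×-dec (b ℚP.≟ d))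

open import Data.List.Membership.DecPropositional _≟ᵢ_ using (_∈_; _∈?_)

claimed : ∀ {p} → True (p ∈? claimedFundamentals) → p ∈ claimedFundamentals
claimed = toWitness

-- The missing combinations, such as 2-1 with q-q, have no case: their indices force 1 + 1 = 1.
solution∈claimed : ∀ {s t s′ t′ q q′} → SumsToOne s s′ q q′ → SumsToZero t t′ q q′ →
                   [ s , t ]· q ∈ claimedFundamentals
solution∈claimed 0+1  0+0  = claimed _
solution∈claimed 0+1  q-q  = claimed _
solution∈claimed 0+1  -q+q = claimed _
solution∈claimed 1+0  0+0  = claimed _
solution∈claimed 1+0  q-q  = claimed _
solution∈claimed 1+0  -q+q = claimed _
solution∈claimed ½+½  0+0  = claimed _
solution∈claimed ½+½  q-q  = claimed _
solution∈claimed ½+½  -q+q = claimed _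
solution∈claimed 2-1  0+0  = claimed _
solution∈claimed -1+2 0+0  = claimed _

fundamental⇒claimed : ∀ {p} → Fundamental p → p ∈ claimedFundamentals
fundamental⇒claimed (p∈H₂ , 1-p∈H₂) with inH₂⇒normalForm p∈H₂ | inH₂⇒normalForm 1-p∈H₂
... | normalForm s t q q-pow refl | normalForm s′ t′ q′ q′-pow 1-p≡p′ =
  solution∈claimed (sumsToOne q-pow q′-pow s s′ (cong re p+p′≡1))
                   (sumsToZero (powerOfTwo-pos q-pow) (powerOfTwo-pos q′-pow) t t′ (cong im p+p′≡1))
  where
  p+p′≡1 : [ s , t ]· q +G [ s′ , t′ ]· q′ ≡ 1G
  p+p′≡1 = 1-p≡p′⇒p+p′≡1 {[ s , t ]· q} 1-p≡p′

monomial : ∀ a b → InH₂ (i^ a *G [1-i]^ b)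
monomial a b = inj₂ (a , b , inj₁ refl)

claimed-fundamental : All Fundamental claimedFundamentals
claimed-fundamental =
    (inj₁ refl                  , monomial (+ 0) (+ 0))
  ∷ (monomial (+ 0) (+ 0)       , inj₁ refl)
  ∷ (monomial (+ 2) (+ 0)       , monomial (+ 1) (+ 2))
  ∷ (monomial (+ 1) (+ 2)       , monomial (+ 2) (+ 0))
  ∷ (monomial (+ 3) -[1+ 1 ]    , monomial (+ 3) -[1+ 1 ])
  ∷ (monomial (+ 1) (+ 0)       , monomial (+ 0) (+ 1))
  ∷ (monomial (+ 1) (+ 1)       , monomial (+ 3) (+ 0))
  ∷ (monomial (+ 0) -[1+ 0 ]    , monomial (+ 3) -[1+ 0 ])
  ∷ (monomial (+ 0) (+ 1)       , monomial (+ 1) (+ 0))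
  ∷ (monomial (+ 3) -[1+ 0 ]    , monomial (+ 0) -[1+ 0 ])
  ∷ (monomial (+ 3) (+ 0)       , monomial (+ 1) (+ 1))
  ∷ []

lemma4p10 : (p : ℚi) → (Fundamental p → p ∈ claimedFundamentals) × (p ∈ claimedFundamentals → Fundamental p)
lemma4p10 p = fundamental⇒claimed , All.lookup claimed-fundamental
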